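{- Let $T$ be a row-increasing triangle of order $n$. Then there exists a monotone triangle $M$ of order $n$ such that, for every $k\in\{1,\dots,n\}$, the integer $k$ occurs as an entry of $M$ the same number of times as it occurs as an entry of $T$.
   Context: Triangles of order $n$ are arranged with $n$ rows, row $k$ (from the top) having $k$ entries, drawn in the usual staggered way so that each entry not in the bottom row has one entry directly south-west and one directly south-east of it in the next row; north-east and south-east lines are the diagonal lines in this arrangement. A row-increasing triangle of order $n$ is such a triangle with entries from $\{1,\dots,n\}$ whose entries are strictly increasing along each row from left to right. A monotone triangle of order $n$ is a row-increasing triangle of order $n$ in which additionally the entries along each north-east line and along each south-east line are weakly increasing. -}

module Defs where

open import Data.Nat using (ℕ; zero; suc; _+_; _≤_; _<_)
open import Data.Nat.Properties using (_≟_)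
open import Relation.Nullary.Decidable using (does)
open import Data.Bool using (if_then_else_)

-- A triangle of order n: entry in row i (0-based, 0 ≤ i < n) and
-- position j (0-based, 0 ≤ j ≤ i) is  T i j .  Values outside the
-- index range  j ≤ i < n  are irrelevant (never inspected).
-- Staggered layout: entry (i , j) has south-west neighbour (i+1 , j)
-- and south-east neighbour (i+1 , j+1).
Triangle : Set
Triangle = ℕ → ℕ → ℕ

EntriesIn : ℕ → Triangle → Set
EntriesIn n T = ∀ i j → i < n → j ≤ i → 1 ≤ T i j × T i j ≤ n
  where open import Data.Product using (_×_)

RowIncreasing : ℕ → Triangle → Set
RowIncreasing n T = ∀ i j → i < n → suc j ≤ i → T i j < T i (suc j)

IsRowIncreasingTriangle : ℕ → Triangle → Set
IsRowIncreasingTriangle n T = EntriesIn n T × RowIncreasing n T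
  where open import Data.Product using (_×_)

SEWeak : ℕ → Triangle → Set
SEWeak n T = ∀ i j → suc i < n → j ≤ i → T i j ≤ T (suc i) (suc j)

NEWeak : ℕ → Triangle → Set
NEWeak n T = ∀ i j → suc i < n → j ≤ i → T (suc i) j ≤ T i j

IsMonotoneTriangle : ℕ → Triangle → Set
IsMonotoneTriangle n T = IsRowIncreasingTriangle n T × SEWeak n T × NEWeak n T
  where open import Data.Product using (_×_)

countRow : Triangle → ℕ → ℕ → ℕ → ℕ
countRow T k i zero = 0
countRow T k i (suc m) = countRow T k i m + (if does (T i m ≟ k) then 1 else 0)

count : Triangle → ℕ → ℕ → ℕ
count T k zero = 0
count T k (suc r) = count T k r + countRow T k r (suc r)

{-# OPTIONS --safe #-}
-- Encode row i of a triangle by its profile x ↦ #{entries ≤ x}. Row-increasing rows are exactly the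
-- staircases from 0 to i + 1 with steps 0 or 1, a triangle is monotone iff consecutive profiles
-- interlace (F i x ≤ F (i + 1) x ≤ F i x + 1), and the number of entries equal to k + 1 is the
-- difference of the column sums of the profiles at k + 1 and k. Replacing two adjacent profiles by
-- the floor and the ceiling of their average keeps both the staircase shape and the column sums,
-- and strictly lowers the energy Σ (F² + (n − i) F) unless the two rows already interlace. Hence
-- finitely many such balancing steps produce interlaced staircases with the column sums of T, and
-- reading them back as rows gives the monotone triangle.
module Submission where

open import Defs
open import Data.Bool using (if_then_else_)
open import Data.Empty using (⊥-elim)
open import Data.Nat
open import Data.Nat.Properties
open import Data.Nat.Tactic.RingSolver using (solve-∀)
open import Data.Product using (Σ; ∃₂; _×_; _,_; proj₁; proj₂)
open import Data.Sum using (_⊎_; inj₁; inj₂)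
open import Function.Base using (_∘_)
open import Function.Bundles using (_⇔_; mk⇔; Equivalence)
open import Relation.Nullary using (¬_; Dec; yes; no)
open import Relation.Nullary.Decidable using (does; dec-true; dec-false; _×-dec_; ¬?; decidable-stable)
open import Relation.Binary.PropositionalEquality

∑ : ℕ → (ℕ → ℕ) → ℕ
∑ zero    f = 0
∑ (suc m) f = ∑ m f + f m

syntax ∑ m (λ i → e) = ∑[ i < m ] e

module _ {f g : ℕ → ℕ} where

  ∑-cong : ∀ m → (∀ i → i < m → f i ≡ g i) → ∑ m f ≡ ∑ m g
  ∑-cong zero    _ = refl
  ∑-cong (suc m) f≡g = cong₂ _+_ (∑-cong m (λ i i<m → f≡g i (m<n⇒m<1+n i<m))) (f≡g m ≤-refl)

  ∑-mono-≤ : ∀ m → (∀ i → i < m → f i ≤ g i) → ∑ m f ≤ ∑ m g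
  ∑-mono-≤ zero    _ = z≤n
  ∑-mono-≤ (suc m) f≤g = +-mono-≤ (∑-mono-≤ m (λ i i<m → f≤g i (m<n⇒m<1+n i<m))) (f≤g m ≤-refl)

  ∑-mono-< : ∀ m → (∀ i → i < m → f i ≤ g i) → ∀ {j} → j < m → f j < g j → ∑ m f < ∑ m g
  ∑-mono-< (suc m) f≤g j<1+m fj<gj with m≤n⇒m<n∨m≡n (s≤s⁻¹ j<1+m)
  ... | inj₁ j<m  = +-mono-<-≤ (∑-mono-< m (λ i i<m → f≤g i (m<n⇒m<1+n i<m)) j<m fj<gj) (f≤g m ≤-refl)
  ... | inj₂ refl = +-mono-≤-< (∑-mono-≤ m (λ i i<m → f≤g i (m<n⇒m<1+n i<m))) fj<gj

  ∑-+ : ∀ m → ∑[ i < m ] (f i + g i) ≡ ∑ m f + ∑ m g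
  ∑-+ zero    = refl
  ∑-+ (suc m) rewrite ∑-+ m = +-assoc-middle (∑ m f) (∑ m g) (f m) (g m)
    where
    +-assoc-middle : ∀ a b c d → a + b + (c + d) ≡ a + c + (b + d)
    +-assoc-middle = solve-∀

  ∑-update₂ : ∀ m p → suc p < m → (∀ i → i < m → i ≢ p → i ≢ suc p → f i ≡ g i) →
              ∑ m f + (g p + g (suc p)) ≡ ∑ m g + (f p + f (suc p))
  ∑-update₂ (suc m) p 1+p<1+m f≡g with m≤n⇒m<n∨m≡n (s≤s⁻¹ 1+p<1+m)
  ... | inj₂ refl rewrite ∑-cong p (λ i i<p → f≡g i (≤-trans i<p (≤-trans (n≤1+n p) (n≤1+n (suc p))))
                                                 (<⇒≢ i<p) (<⇒≢ (m<n⇒m<1+n i<p)))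
    = swap (∑ p g) (f p) (f (suc p)) (g p) (g (suc p))
    where
    swap : ∀ s a b c d → s + a + b + (c + d) ≡ s + c + d + (a + b)
    swap = solve-∀
  ... | inj₁ 1+p<m = begin
      ∑ m f + f m + (g p + g (suc p))   ≡⟨ swap (∑ m f) (f m) _ ⟩
      ∑ m f + (g p + g (suc p)) + f m   ≡⟨ cong₂ _+_ (∑-update₂ m p 1+p<m (λ i i<m → f≡g i (m<n⇒m<1+n i<m)))
                                                     (f≡g m ≤-refl (<⇒≢ (<-trans (n<1+n p) 1+p<m) ∘ sym) (<⇒≢ 1+p<m ∘ sym)) ⟩
      ∑ m g + (f p + f (suc p)) + g m   ≡⟨ swap (∑ m g) _ (g m) ⟩
      ∑ m g + g m + (f p + f (suc p))   ∎
    where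
    open ≡-Reasoning
    swap : ∀ s a b → s + a + b ≡ s + b + a
    swap = solve-∀

module _ {f : ℕ → ℕ} where

  ∑-const : ∀ m {c} → (∀ i → i < m → f i ≡ c) → ∑ m f ≡ m * c
  ∑-const zero    _ = refl
  ∑-const (suc m) {c} f≡c rewrite ∑-const m (λ i i<m → f≡c i (m<n⇒m<1+n i<m)) | f≡c m ≤-refl = +-comm (m * c) c

  ∑-bounded : ∀ m {c} → (∀ i → i < m → f i ≤ c) → ∑ m f ≤ m * c
  ∑-bounded zero    _ = z≤n
  ∑-bounded (suc m) {c} f≤c = ≤-trans (+-mono-≤ (∑-bounded m (λ i i<m → f≤c i (m<n⇒m<1+n i<m))) (f≤c m ≤-refl))
                                      (≤-reflexive (+-comm (m * c) c))

  ∑-prefix : ∀ {t m} → t ≤ m → ∑ t f ≤ ∑ m f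
  ∑-prefix {m = m} t≤m with m≤n⇒m<n∨m≡n t≤m
  ∑-prefix {m = suc m} _ | inj₁ t<1+m = ≤-trans (∑-prefix (s≤s⁻¹ t<1+m)) (m≤m+n (∑ m f) (f m))
  ...                                  | inj₂ refl = ≤-refl

  ∑-lower : ∀ m t → t ≤ m → (∀ i → i < t → f i ≡ 1) → t ≤ ∑ m f
  ∑-lower m t t≤m f≡1 = ≤-trans (≤-reflexive (sym (trans (∑-const t f≡1) (*-identityʳ t)))) (∑-prefix t≤m)

  ∑-upper : ∀ m t → (∀ i → i < m → f i ≤ 1) → (∀ i → t ≤ i → i < m → f i ≡ 0) → ∑ m f ≤ t
  ∑-upper zero    t _ _ = z≤n
  ∑-upper (suc m) t f≤1 f≡0 with t ≤? m
  ... | yes t≤m rewrite f≡0 m t≤m ≤-refl | +-identityʳ (∑ m f) =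
        ∑-upper m t (λ i i<m → f≤1 i (m<n⇒m<1+n i<m)) (λ i t≤i i<m → f≡0 i t≤i (m<n⇒m<1+n i<m))
  ... | no  t≰m = ≤-trans (∑-bounded (suc m) f≤1) (≤-trans (≤-reflexive (*-identityʳ (suc m))) (≰⇒> t≰m))

𝟙[_≤_] : ℕ → ℕ → ℕ
𝟙[ a ≤ b ] = if does (a ≤? b) then 1 else 0

𝟙[_≡_] : ℕ → ℕ → ℕ
𝟙[ a ≡ b ] = if does (a ≟ b) then 1 else 0

𝟙≤-yes : ∀ {a b} → a ≤ b → 𝟙[ a ≤ b ] ≡ 1
𝟙≤-yes {a} {b} a≤b = cong (if_then 1 else 0) (dec-true (a ≤? b) a≤b)

𝟙≤-no : ∀ {a b} → ¬ a ≤ b → 𝟙[ a ≤ b ] ≡ 0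
𝟙≤-no {a} {b} a≰b = cong (if_then 1 else 0) (dec-false (a ≤? b) a≰b)

𝟙≡-yes : ∀ a → 𝟙[ a ≡ a ] ≡ 1
𝟙≡-yes a = cong (if_then 1 else 0) (dec-true (a ≟ a) refl)

𝟙≡-no : ∀ {a b} → a ≢ b → 𝟙[ a ≡ b ] ≡ 0
𝟙≡-no {a} {b} a≢b = cong (if_then 1 else 0) (dec-false (a ≟ b) a≢b)

𝟙≤-≤1 : ∀ a b → 𝟙[ a ≤ b ] ≤ 1
𝟙≤-≤1 a b with a ≤? b
... | yes a≤b = ≤-reflexive (𝟙≤-yes a≤b)
... | no  a≰b = ≤-trans (≤-reflexive (𝟙≤-no a≰b)) z≤n

𝟙≤-cong : ∀ {a b c d} → (a ≤ b ⇔ c ≤ d) → 𝟙[ a ≤ b ] ≡ 𝟙[ c ≤ d ]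
𝟙≤-cong {a} {b} {c} {d} a≤b⇔c≤d with a ≤? b
... | yes a≤b = trans (𝟙≤-yes a≤b) (sym (𝟙≤-yes (Equivalence.to a≤b⇔c≤d a≤b)))
... | no  a≰b = trans (𝟙≤-no a≰b) (sym (𝟙≤-no (a≰b ∘ Equivalence.from a≤b⇔c≤d)))

𝟙≡+𝟙≤ : ∀ t k → 𝟙[ t ≡ suc k ] + 𝟙[ t ≤ k ] ≡ 𝟙[ t ≤ suc k ]
𝟙≡+𝟙≤ t k with t ≟ suc k
... | yes refl rewrite 𝟙≡-yes (suc k) | 𝟙≤-no (1+n≰n {k}) | 𝟙≤-yes (≤-refl {suc k}) = refl
... | no  t≢1+k with t ≤? k
...   | yes t≤k rewrite 𝟙≡-no t≢1+k | 𝟙≤-yes t≤k | 𝟙≤-yes (m≤n⇒m≤1+n t≤k) = refl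
...   | no  t≰k rewrite 𝟙≡-no t≢1+k | 𝟙≤-no t≰k | 𝟙≤-no (λ t≤1+k → t≢1+k (≤-antisym t≤1+k (≰⇒> t≰k))) = refl

stepwise-mono : ∀ {f : ℕ → ℕ} {m} → (∀ x → x < m → f x ≤ f (suc x)) → ∀ {x y} → x ≤ y → y ≤ m → f x ≤ f y
stepwise-mono {f} step {x} {y} x≤y y≤m with m≤n⇒m<n∨m≡n x≤y
... | inj₂ refl = ≤-refl
stepwise-mono {f} step {x} {suc y} _ y<m | inj₁ x<1+y =
  ≤-trans (stepwise-mono step (s≤s⁻¹ x<1+y) (<⇒≤ y<m)) (step y y<m)

countRow≡∑ : ∀ T k i m → countRow T k i m ≡ ∑[ j < m ] 𝟙[ T i j ≡ k ]
countRow≡∑ T k i zero    = refl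
countRow≡∑ T k i (suc m) = cong (_+ 𝟙[ T i m ≡ k ]) (countRow≡∑ T k i m)

count≡∑ : ∀ T k r → count T k r ≡ ∑[ i < r ] countRow T k i (suc i)
count≡∑ T k zero    = refl
count≡∑ T k (suc r) = cong (_+ countRow T k r (suc r)) (count≡∑ T k r)

Profile : Set
Profile = ℕ → ℕ → ℕ

profile : Triangle → Profile
profile T i x = ∑[ j < suc i ] 𝟙[ T i j ≤ x ]

countRow+profile : ∀ T k i → countRow T (suc k) i (suc i) + profile T i k ≡ profile T i (suc k)
countRow+profile T k i = begin
  countRow T (suc k) i (suc i) + profile T i k                              ≡⟨ cong (_+ profile T i k) (countRow≡∑ T (suc k) i (suc i)) ⟩
  ∑[ j < suc i ] 𝟙[ T i j ≡ suc k ] + profile T i k                         ≡⟨ ∑-+ (suc i) ⟨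
  ∑[ j < suc i ] (𝟙[ T i j ≡ suc k ] + 𝟙[ T i j ≤ k ])                      ≡⟨ ∑-cong (suc i) (λ j _ → 𝟙≡+𝟙≤ (T i j) k) ⟩
  profile T i (suc k)                                                        ∎
  where open ≡-Reasoning

count+profiles : ∀ T k n → count T (suc k) n + ∑[ i < n ] profile T i k ≡ ∑[ i < n ] profile T i (suc k)
count+profiles T k n = begin
  count T (suc k) n + ∑[ i < n ] profile T i k                                 ≡⟨ cong (_+ ∑[ i < n ] profile T i k) (count≡∑ T (suc k) n) ⟩
  ∑[ i < n ] countRow T (suc k) i (suc i) + ∑[ i < n ] profile T i k          ≡⟨ ∑-+ n ⟨
  ∑[ i < n ] (countRow T (suc k) i (suc i) + profile T i k)                   ≡⟨ ∑-cong n (λ i _ → countRow+profile T k i) ⟩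
  ∑[ i < n ] profile T i (suc k)                                               ∎
  where open ≡-Reasoning

SameColumnSums : ℕ → Profile → Profile → Set
SameColumnSums n F G = ∀ x → ∑[ i < n ] F i x ≡ ∑[ i < n ] G i x

count-by-column-sums : ∀ n k (M T : Triangle) → suc k ≤ n →
                       (∀ x → x ≤ n → ∑[ i < n ] profile M i x ≡ ∑[ i < n ] profile T i x) →
                       count M (suc k) n ≡ count T (suc k) n
count-by-column-sums n k M T 1+k≤n same = +-cancelʳ-≡ (∑[ i < n ] profile T i k) _ _ (begin
  count M (suc k) n + ∑[ i < n ] profile T i k    ≡⟨ cong (count M (suc k) n +_) (same k (<⇒≤ 1+k≤n)) ⟨
  count M (suc k) n + ∑[ i < n ] profile M i k    ≡⟨ count+profiles M k n ⟩
  ∑[ i < n ] profile M i (suc k)                  ≡⟨ same (suc k) 1+k≤n ⟩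
  ∑[ i < n ] profile T i (suc k)                  ≡⟨ count+profiles T k n ⟨
  count T (suc k) n + ∑[ i < n ] profile T i k    ∎)
  where open ≡-Reasoning

UnitStep : ℕ → ℕ → Set
UnitStep a b = a ≤ b × b ≤ suc a

unitStep? : ∀ a b → Dec (UnitStep a b)
unitStep? a b = a ≤? b ×-dec b ≤? suc a

record Staircase (n h : ℕ) (f : ℕ → ℕ) : Set where
  field
    start : f 0 ≡ 0
    end   : f n ≡ h
    step  : ∀ x → x < n → UnitStep (f x) (f (suc x))

  mono : ∀ {x y} → x ≤ y → y ≤ n → f x ≤ f y
  mono = stepwise-mono (λ x x<n → proj₁ (step x x<n))

  ≤-height : ∀ {x} → x ≤ n → f x ≤ h
  ≤-height x≤n = ≤-trans (mono x≤n ≤-refl) (≤-reflexive end)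

IsProfile : ℕ → Profile → Set
IsProfile n F = ∀ i → i < n → Staircase n (suc i) (F i)

Interlaced : ℕ → Profile → Set
Interlaced n F = ∀ i x → suc i < n → x ≤ n → UnitStep (F i x) (F (suc i) x)

increasing⇒< : ∀ {f : ℕ → ℕ} {m} → (∀ j → suc j < m → f j < f (suc j)) → ∀ {i j} → i < j → j < m → f i < f j
increasing⇒< {f} inc {i} {suc j} i<1+j 1+j<m with m≤n⇒m<n∨m≡n (s≤s⁻¹ i<1+j)
... | inj₁ i<j  = <-trans (increasing⇒< inc i<j (<-trans (n<1+n j) 1+j<m)) (inc j 1+j<m)
... | inj₂ refl = inc i 1+j<m

increasing⇒occursAtMostOnce : ∀ {f : ℕ → ℕ} {m} → (∀ j → suc j < m → f j < f (suc j)) →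
                              ∀ v → ∑[ j < m ] 𝟙[ f j ≡ v ] ≤ 1
increasing⇒occursAtMostOnce {m = zero}      inc v = z≤n
increasing⇒occursAtMostOnce {f} {m = suc m} inc v with f m ≟ v
... | yes refl = ≤-reflexive (begin
      ∑[ j < m ] 𝟙[ f j ≡ f m ] + 𝟙[ f m ≡ f m ]  ≡⟨ cong₂ _+_ (∑-const m (λ j j<m → 𝟙≡-no (<⇒≢ (increasing⇒< inc j<m ≤-refl))))
                                                                (𝟙≡-yes (f m)) ⟩
      m * 0 + 1                                    ≡⟨ cong (_+ 1) (*-zeroʳ m) ⟩
      1                                            ∎)
  where open ≡-Reasoning
... | no  fm≢v rewrite 𝟙≡-no fm≢v | +-identityʳ (∑[ j < m ] 𝟙[ f j ≡ v ]) =
      increasing⇒occursAtMostOnce (λ j 1+j<m → inc j (m<n⇒m<1+n 1+j<m)) v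

profile-isProfile : ∀ {n T} → IsRowIncreasingTriangle n T → IsProfile n (profile T)
profile-isProfile {n} {T} (entries , increasing) i i<n = record
  { start = trans (∑-const (suc i) (λ j j<1+i → 𝟙≤-no (<⇒≱ (proj₁ (entries i j i<n (s≤s⁻¹ j<1+i))))))
                  (*-zeroʳ (suc i))
  ; end   = trans (∑-const (suc i) (λ j j<1+i → 𝟙≤-yes (proj₂ (entries i j i<n (s≤s⁻¹ j<1+i)))))
                  (*-identityʳ (suc i))
  ; step  = step
  }
  where
  step : ∀ x → x < n → UnitStep (profile T i x) (profile T i (suc x))
  step x _ rewrite sym (countRow+profile T x i) =
    m≤n+m (profile T i x) (countRow T (suc x) i (suc i)) , +-monoˡ-≤ (profile T i x) atMostOnce
    where
    atMostOnce : countRow T (suc x) i (suc i) ≤ 1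
    atMostOnce rewrite countRow≡∑ T (suc x) i (suc i) =
      increasing⇒occursAtMostOnce (λ j 1+j<1+i → increasing i j i<n (s≤s⁻¹ 1+j<1+i)) (suc x)

∑𝟙[suc≤]≡ : ∀ m {c} → c ≤ m → ∑[ j < m ] 𝟙[ suc j ≤ c ] ≡ c
∑𝟙[suc≤]≡ m {c} c≤m = ≤-antisym
  (∑-upper m c (λ j _ → 𝟙≤-≤1 (suc j) c) (λ j c≤j _ → 𝟙≤-no (<⇒≱ (s≤s c≤j))))
  (∑-lower m c c≤m (λ j j<c → 𝟙≤-yes j<c))

∑𝟙≤-≤⇔ : ∀ {g : ℕ → ℕ} {m} → (∀ x → x < m → g x ≤ g (suc x)) → ∀ j {k} → k < m →
         ∑[ x < m ] 𝟙[ g x ≤ j ] ≤ k ⇔ j < g k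
∑𝟙≤-≤⇔ {g} {m} step j {k} k<m = mk⇔ to from
  where
  to : ∑[ x < m ] 𝟙[ g x ≤ j ] ≤ k → j < g k
  to ∑≤k with g k ≤? j
  ... | no  gk≰j = ≰⇒> gk≰j
  ... | yes gk≤j = ⊥-elim (≤⇒≯ ∑≤k (∑-lower m (suc k) k<m
                     (λ x x<1+k → 𝟙≤-yes (≤-trans (stepwise-mono step (s≤s⁻¹ x<1+k) (<⇒≤ k<m)) gk≤j))))

  from : j < g k → ∑[ x < m ] 𝟙[ g x ≤ j ] ≤ k
  from j<gk = ∑-upper m k (λ x _ → 𝟙≤-≤1 (g x) j)
                (λ x k≤x x<m → 𝟙≤-no (<⇒≱ (<-≤-trans j<gk (stepwise-mono step k≤x (<⇒≤ x<m)))))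

-- The entry in position j of row i is the least x with F i x > j.
inverse : ℕ → Profile → Triangle
inverse n F i j = ∑[ x < n ] 𝟙[ F i x ≤ j ]

module Inverse {n : ℕ} {F : Profile} (isProfile : IsProfile n F) where
  module Row {i} (i<n : i < n) = Staircase (isProfile i i<n)

  M : Triangle
  M = inverse n F

  ≤⇔< : ∀ i j k → i < n → j ≤ i → k ≤ n → M i j ≤ k ⇔ j < F i k
  ≤⇔< i j k i<n j≤i k≤n with m≤n⇒m<n∨m≡n k≤n
  ... | inj₁ k<n  = ∑𝟙≤-≤⇔ (λ x x<n → proj₁ (Row.step i<n x x<n)) j k<n
  ... | inj₂ refl = mk⇔ (λ _ → subst (j <_) (sym (Row.end i<n)) (s≤s j≤i))
                        (λ _ → ≤-trans (∑-bounded n (λ x _ → 𝟙≤-≤1 (F i x) j)) (≤-reflexive (*-identityʳ n)))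

  entries : EntriesIn n M
  entries i j i<n j≤i =
    ≰⇒> (λ M≤0 → n≮0 (subst (j <_) (Row.start i<n) (Equivalence.to (≤⇔< i j 0 i<n j≤i z≤n) M≤0))) ,
    Equivalence.from (≤⇔< i j n i<n j≤i ≤-refl) (subst (j <_) (sym (Row.end i<n)) (s≤s j≤i))

  profile-at-entry : ∀ i j → i < n → j ≤ i → F i (M i j) ≤ suc j
  profile-at-entry i j i<n j≤i = subst (λ K → F i K ≤ suc j) 1+k≡M below
    where
    k = pred (M i j)
    1+k≡M : suc k ≡ M i j
    1+k≡M = suc-pred (M i j) {{>-nonZero (proj₁ (entries i j i<n j≤i))}}
    k<M : k < M i j
    k<M = ≤-reflexive 1+k≡M
    k<n : k < n
    k<n = <-≤-trans k<M (proj₂ (entries i j i<n j≤i))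
    below : F i (suc k) ≤ suc j
    below = ≤-trans (proj₂ (Row.step i<n k k<n))
                    (s≤s (≮⇒≥ (<⇒≱ k<M ∘ Equivalence.from (≤⇔< i j k i<n j≤i (<⇒≤ k<n)))))

  rowIncreasing : RowIncreasing n M
  rowIncreasing i j i<n 1+j≤i = ≰⇒> (λ M[1+j]≤M[j] → 1+n≰n (≤-trans
    (Equivalence.to (≤⇔< i (suc j) (M i j) i<n 1+j≤i (proj₂ (entries i j i<n j≤i))) M[1+j]≤M[j])
    (profile-at-entry i j i<n j≤i)))
    where
    j≤i = ≤-trans (n≤1+n j) 1+j≤i

  module _ (interlaced : Interlaced n F) where

    southEast : SEWeak n M
    southEast i j 1+i<n j≤i = Equivalence.from (≤⇔< i j K i<n j≤i K≤n)
      (s≤s⁻¹ (≤-trans (Equivalence.to (≤⇔< (suc i) (suc j) K 1+i<n (s≤s j≤i) K≤n) ≤-refl)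
                      (proj₂ (interlaced i K 1+i<n K≤n))))
      where
      i<n = <-trans (n<1+n i) 1+i<n
      K = M (suc i) (suc j)
      K≤n = proj₂ (entries (suc i) (suc j) 1+i<n (s≤s j≤i))

    northEast : NEWeak n M
    northEast i j 1+i<n j≤i = Equivalence.from (≤⇔< (suc i) j K 1+i<n (m≤n⇒m≤1+n j≤i) K≤n)
      (<-≤-trans (Equivalence.to (≤⇔< i j K i<n j≤i K≤n) ≤-refl) (proj₁ (interlaced i K 1+i<n K≤n)))
      where
      i<n = <-trans (n<1+n i) 1+i<n
      K = M i j
      K≤n = proj₂ (entries i j i<n j≤i)

    isMonotone : IsMonotoneTriangle n M
    isMonotone = (entries , rowIncreasing) , southEast , northEast

  profile-inverse : ∀ i x → i < n → x ≤ n → profile M i x ≡ F i x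
  profile-inverse i x i<n x≤n = trans
    (∑-cong (suc i) (λ j j<1+i → 𝟙≤-cong (≤⇔< i j x i<n (s≤s⁻¹ j<1+i) x≤n)))
    (∑𝟙[suc≤]≡ (suc i) (Row.≤-height i<n x≤n))

halves-unitStep : ∀ s → UnitStep ⌊ s /2⌋ ⌈ s /2⌉
halves-unitStep s = ⌊n/2⌋≤⌈n/2⌉ s , ⌊n/2⌋-mono (n≤1+n (suc s))

⌊/2⌋-unitStep : ∀ {s t} → s ≤ t → t ≤ 2 + s → UnitStep ⌊ s /2⌋ ⌊ t /2⌋
⌊/2⌋-unitStep s≤t t≤2+s = ⌊n/2⌋-mono s≤t , ⌊n/2⌋-mono t≤2+s

unitStep-+ : ∀ {a b c d} → UnitStep a b → UnitStep c d → a + c ≤ b + d × b + d ≤ 2 + (a + c)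
unitStep-+ {a} {c = c} (a≤b , b≤1+a) (c≤d , d≤1+c) =
  +-mono-≤ a≤b c≤d , ≤-trans (+-mono-≤ b≤1+a d≤1+c) (≤-reflexive (cong suc (+-suc a c)))

module _ {n h : ℕ} {f g : ℕ → ℕ} (sf : Staircase n h f) (sg : Staircase n (suc h) g) where
  private
    module f = Staircase sf
    module g = Staircase sg

    sum-step : ∀ x → x < n → f x + g x ≤ f (suc x) + g (suc x) × f (suc x) + g (suc x) ≤ 2 + (f x + g x)
    sum-step x x<n = unitStep-+ (f.step x x<n) (g.step x x<n)

    sum-end : f n + g n ≡ suc (h + h)
    sum-end = trans (cong₂ _+_ f.end g.end) (+-suc h h)

  ⌊+/2⌋-staircase : Staircase n h (λ x → ⌊ f x + g x /2⌋)
  ⌊+/2⌋-staircase = record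
    { start = cong ⌊_/2⌋ (cong₂ _+_ f.start g.start)
    ; end   = trans (cong ⌊_/2⌋ sum-end) (sym (n≡⌈n+n/2⌉ h))
    ; step  = λ x x<n → ⌊/2⌋-unitStep (proj₁ (sum-step x x<n)) (proj₂ (sum-step x x<n))
    }

  ⌈+/2⌉-staircase : Staircase n (suc h) (λ x → ⌈ f x + g x /2⌉)
  ⌈+/2⌉-staircase = record
    { start = cong ⌈_/2⌉ (cong₂ _+_ f.start g.start)
    ; end   = trans (cong ⌈_/2⌉ sum-end) (cong suc (sym (n≡⌊n+n/2⌋ h)))
    ; step  = λ x x<n → ⌊/2⌋-unitStep (s≤s (proj₁ (sum-step x x<n))) (s≤s (proj₂ (sum-step x x<n)))
    }

balance : ℕ → Profile → Profile
balance p F i x with i ≟ p | i ≟ suc p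
... | yes _ | _     = ⌊ F p x + F (suc p) x /2⌋
... | no  _ | yes _ = ⌈ F p x + F (suc p) x /2⌉
... | no  _ | no  _ = F i x

balance-at : ∀ p F x → balance p F p x ≡ ⌊ F p x + F (suc p) x /2⌋
balance-at p F x with p ≟ p
... | yes _  = refl
... | no p≢p = ⊥-elim (p≢p refl)

balance-at-suc : ∀ p F x → balance p F (suc p) x ≡ ⌈ F p x + F (suc p) x /2⌉
balance-at-suc p F x with suc p ≟ p | suc p ≟ suc p
... | yes 1+p≡p | _     = ⊥-elim (1+n≢n 1+p≡p)
... | no  _     | yes _ = refl
... | no  _     | no 1+p≢1+p = ⊥-elim (1+p≢1+p refl)

balance-elsewhere : ∀ p F i x → i ≢ p → i ≢ suc p → balance p F i x ≡ F i x
balance-elsewhere p F i x i≢p i≢1+p with i ≟ p | i ≟ suc p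
... | yes i≡p | _         = ⊥-elim (i≢p i≡p)
... | no  _   | yes i≡1+p = ⊥-elim (i≢1+p i≡1+p)
... | no  _   | no  _     = refl

balance-isProfile : ∀ {n p F} → suc p < n → IsProfile n F → IsProfile n (balance p F)
balance-isProfile {n} {p} {F} 1+p<n isProfile i i<n with i ≟ p | i ≟ suc p
... | yes refl | _        = ⌊+/2⌋-staircase (isProfile p i<n) (isProfile (suc p) 1+p<n)
... | no _     | yes refl = ⌈+/2⌉-staircase (isProfile p (<-trans (n<1+n p) 1+p<n)) (isProfile (suc p) 1+p<n)
... | no _     | no _     = isProfile i i<n

balance-sameColumnSums : ∀ {n p} F → suc p < n → SameColumnSums n (balance p F) F
balance-sameColumnSums {n} {p} F 1+p<n x = +-cancelʳ-≡ (F p x + F (suc p) x) _ _ (begin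
  ∑[ i < n ] balance p F i x + (F p x + F (suc p) x)                 ≡⟨ ∑-update₂ n p 1+p<n (λ i _ → balance-elsewhere p F i x) ⟩
  ∑[ i < n ] F i x + (balance p F p x + balance p F (suc p) x)       ≡⟨ cong (∑[ i < n ] F i x +_) halves ⟩
  ∑[ i < n ] F i x + (F p x + F (suc p) x)                           ∎)
  where
  open ≡-Reasoning
  halves : balance p F p x + balance p F (suc p) x ≡ F p x + F (suc p) x
  halves = trans (cong₂ _+_ (balance-at p F x) (balance-at-suc p F x)) (⌊n/2⌋+⌈n/2⌉≡n _)

-- The weight n ∸ i breaks the tie between (a , a + 1) and (a + 1 , a) in favour of interlacing.
energy : ℕ → ℕ → ℕ → ℕ
energy n i v = v * v + (n ∸ i) * v

pairEnergy : ℕ → ℕ → ℕ → ℕ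
pairEnergy w a b = (a * a + suc w * a) + (b * b + w * b)

energy-pair : ∀ {n p} a b → suc p ≤ n → energy n p a + energy n (suc p) b ≡ pairEnergy (n ∸ suc p) a b
energy-pair {n} {p} a b 1+p≤n rewrite +-∸-assoc 1 1+p≤n = refl

-- 2 · pairEnergy w a b = balancedEnergy w (a + b) + d (d − 1) with d = b − a, and d (d − 1)
-- vanishes exactly when d ∈ {0, 1}.
balancedEnergy : ℕ → ℕ → ℕ
balancedEnergy w s = s * suc s + 2 * (w * s)

pairEnergy-unitStep : ∀ w {a b} → UnitStep a b → 2 * pairEnergy w a b ≡ balancedEnergy w (a + b)
pairEnergy-unitStep w {a} (a≤b , b≤1+a) with m≤n⇒m<n∨m≡n a≤b
... | inj₂ refl = diagonal w a
  where
  diagonal : ∀ w a → 2 * ((a * a + suc w * a) + (a * a + w * a)) ≡ (a + a) * suc (a + a) + 2 * (w * (a + a))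
  diagonal = solve-∀
... | inj₁ a<b with ≤-antisym a<b b≤1+a
...   | refl = successor w a
  where
  successor : ∀ w a → 2 * ((a * a + suc w * a) + (suc a * suc a + w * suc a)) ≡
              (a + suc a) * suc (a + suc a) + 2 * (w * (a + suc a))
  successor = solve-∀

pairEnergy-not-unitStep : ∀ w {a b} → ¬ UnitStep a b → balancedEnergy w (a + b) < 2 * pairEnergy w a b
pairEnergy-not-unitStep w {a} {b} ¬step with a ≤? b
... | no a≰b with m≤n⇒∃[o]m+o≡n (≰⇒> a≰b)
...   | k , refl = ≤-trans (m<m+n _ z<s) (≤-reflexive (descent w b k))
  where
  descent : ∀ w b k → let a = suc (b + k) in
            (a + b) * suc (a + b) + 2 * (w * (a + b)) + suc k * suc (suc k) ≡ 2 * ((a * a + suc w * a) + (b * b + w * b))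
  descent = solve-∀
pairEnergy-not-unitStep w {a} {b} ¬step | yes a≤b with m≤n⇒∃[o]m+o≡n (≰⇒> (¬step ∘ (a≤b ,_)))
...   | k , refl = ≤-trans (m<m+n _ z<s) (≤-reflexive (ascent w a k))
  where
  ascent : ∀ w a k → let b = suc (suc (a + k)) in
           (a + b) * suc (a + b) + 2 * (w * (a + b)) + suc (suc k) * suc k ≡ 2 * ((a * a + suc w * a) + (b * b + w * b))
  ascent = solve-∀

pairEnergy-lower : ∀ w a b → balancedEnergy w (a + b) ≤ 2 * pairEnergy w a b
pairEnergy-lower w a b with unitStep? a b
... | yes step  = ≤-reflexive (sym (pairEnergy-unitStep w step))
... | no  ¬step = <⇒≤ (pairEnergy-not-unitStep w ¬step)

halves-pairEnergy : ∀ w a b → 2 * pairEnergy w ⌊ a + b /2⌋ ⌈ a + b /2⌉ ≡ balancedEnergy w (a + b)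
halves-pairEnergy w a b = trans (pairEnergy-unitStep w (halves-unitStep (a + b)))
                                (cong (balancedEnergy w) (⌊n/2⌋+⌈n/2⌉≡n (a + b)))

halves-pairEnergy-≤ : ∀ w a b → pairEnergy w ⌊ a + b /2⌋ ⌈ a + b /2⌉ ≤ pairEnergy w a b
halves-pairEnergy-≤ w a b = *-cancelˡ-≤ 2 (≤-trans (≤-reflexive (halves-pairEnergy w a b)) (pairEnergy-lower w a b))

halves-pairEnergy-< : ∀ w {a b} → ¬ UnitStep a b → pairEnergy w ⌊ a + b /2⌋ ⌈ a + b /2⌉ < pairEnergy w a b
halves-pairEnergy-< w {a} {b} ¬step =
  *-cancelˡ-< 2 _ _ (≤-trans (s≤s (≤-reflexive (halves-pairEnergy w a b))) (pairEnergy-not-unitStep w ¬step))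

columnEnergy : ℕ → Profile → ℕ → ℕ
columnEnergy n F x = ∑[ i < n ] energy n i (F i x)

Φ : ℕ → Profile → ℕ
Φ n F = ∑[ x < suc n ] columnEnergy n F x

module _ {n p : ℕ} (F : Profile) (1+p<n : suc p < n) (x : ℕ) where
  private
    w = n ∸ suc p
    a = F p x
    b = F (suc p) x

  balance-columnEnergy : columnEnergy n (balance p F) x + pairEnergy w a b ≡
                         columnEnergy n F x + pairEnergy w ⌊ a + b /2⌋ ⌈ a + b /2⌉
  balance-columnEnergy = begin
    columnEnergy n (balance p F) x + pairEnergy w a b
      ≡⟨ cong (columnEnergy n (balance p F) x +_) (energy-pair a b (<⇒≤ 1+p<n)) ⟨
    columnEnergy n (balance p F) x + (energy n p a + energy n (suc p) b)
      ≡⟨ ∑-update₂ n p 1+p<n (λ i _ i≢p i≢1+p → cong (energy n i) (balance-elsewhere p F i x i≢p i≢1+p)) ⟩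
    columnEnergy n F x + (energy n p (balance p F p x) + energy n (suc p) (balance p F (suc p) x))
      ≡⟨ cong (columnEnergy n F x +_) (trans (cong₂ (λ u v → energy n p u + energy n (suc p) v)
                                                     (balance-at p F x) (balance-at-suc p F x))
                                              (energy-pair ⌊ a + b /2⌋ ⌈ a + b /2⌉ (<⇒≤ 1+p<n))) ⟩
    columnEnergy n F x + pairEnergy w ⌊ a + b /2⌋ ⌈ a + b /2⌉
      ∎
    where open ≡-Reasoning

  balance-columnEnergy-≤ : columnEnergy n (balance p F) x ≤ columnEnergy n F x
  balance-columnEnergy-≤ = +-cancelʳ-≤ (pairEnergy w a b) _ _ (≤-trans (≤-reflexive balance-columnEnergy)
                             (+-monoʳ-≤ (columnEnergy n F x) (halves-pairEnergy-≤ w a b)))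

  balance-columnEnergy-< : ¬ UnitStep a b → columnEnergy n (balance p F) x < columnEnergy n F x
  balance-columnEnergy-< ¬step = +-cancelʳ-< (pairEnergy w a b) _ _ (≤-<-trans (≤-reflexive balance-columnEnergy)
                                   (+-monoʳ-< (columnEnergy n F x) (halves-pairEnergy-< w ¬step)))

Φ-balance-< : ∀ {n p x} F → suc p < n → x ≤ n → ¬ UnitStep (F p x) (F (suc p) x) → Φ n (balance p F) < Φ n F
Φ-balance-< {n} F 1+p<n x≤n ¬step =
  ∑-mono-< (suc n) (λ y _ → balance-columnEnergy-≤ F 1+p<n y) (s≤s x≤n) (balance-columnEnergy-< F 1+p<n _ ¬step)

interlaced-or-defect : ∀ n F → Interlaced n F ⊎ ∃₂ λ p x → suc p < n × x ≤ n × ¬ UnitStep (F p x) (F (suc p) x)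
interlaced-or-defect zero    F = inj₁ λ _ _ ()
interlaced-or-defect (suc n) F with anyUpTo? (λ p → anyUpTo? (λ x → ¬? (unitStep? (F p x) (F (suc p) x))) (suc (suc n))) n
... | yes (p , p<n , x , x<2+n , ¬step) = inj₂ (p , x , s≤s p<n , s≤s⁻¹ x<2+n , ¬step)
... | no  ¬defect = inj₁ λ p x 1+p<1+n x≤1+n → decidable-stable (unitStep? _ _)
                      (λ ¬step → ¬defect (p , s≤s⁻¹ 1+p<1+n , x , s≤s x≤1+n , ¬step))

Interlacing : ℕ → Profile → Set
Interlacing n F = Σ Profile λ G → IsProfile n G × Interlaced n G × SameColumnSums n G F

interlace : ∀ {n F} → IsProfile n F → Interlacing n F
interlace {n} {F} = descend (suc (Φ n F)) F ≤-refl
  where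
  descend : ∀ bound F → Φ n F < bound → IsProfile n F → Interlacing n F
  descend (suc bound) F Φ<1+bound isProfile with interlaced-or-defect n F
  ... | inj₁ interlaced = F , isProfile , interlaced , λ _ → refl
  ... | inj₂ (p , x , 1+p<n , x≤n , ¬step)
    with descend bound (balance p F) (<-≤-trans (Φ-balance-< F 1+p<n x≤n ¬step) (s≤s⁻¹ Φ<1+bound))
                 (balance-isProfile 1+p<n isProfile)
  ...   | G , isProfileG , interlacedG , sameG =
          G , isProfileG , interlacedG , λ y → trans (sameG y) (balance-sameColumnSums F 1+p<n y)

lemma2p6 : (n : ℕ) (T : Triangle) → IsRowIncreasingTriangle n T →
    Σ Triangle (λ M → IsMonotoneTriangle n M ×
      ((k : ℕ) → 1 ≤ k → k ≤ n → count M k n ≡ count T k n))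
lemma2p6 n T isRowIncreasing with interlace (profile-isProfile isRowIncreasing)
... | G , isProfile , interlaced , sameColumnSums = M , isMonotone interlaced , counts
  where
  open Inverse isProfile

  counts : (k : ℕ) → 1 ≤ k → k ≤ n → count M k n ≡ count T k n
  counts (suc k) _ 1+k≤n = count-by-column-sums n k M T 1+k≤n λ x x≤n →
    trans (∑-cong n (λ i i<n → profile-inverse i x i<n x≤n)) (sameColumnSums x)
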